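{- Let $R$ be a monotone transit function on a non-empty finite set $V$ satisfying (l1) and (l2) below. Then $\mathscr{C}_R=\{R(x,y)\mid x,y\in V\}$ is totally balanced ($\beta$-acyclic). (l1): for all $x,y,p,q,u,v\in V$, if $R(x,y)\between R(p,q)$ and $R(p,q)\between R(u,v)$, then $R(x,y)\subseteq R(u,v)$, or $R(u,v)\subseteq R(x,y)$, or $R(x,y)\cap R(u,v)\subseteq R(p,q)\subseteq R(x,y)\cup R(u,v)$. (l2): for all $x,y,p,q,u,v\in V$, if $R(x,y)\between R(p,q)$, $R(p,q)\between R(u,v)$ and $R(x,y)\cap R(u,v)=\emptyset$, then $R(x,y)\cup R(p,q)\cup R(u,v)=R(s,t)$ for some $s\in R(x,y)\setminus R(p,q)$ and $t\in R(u,v)\setminus R(p,q)$.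
   Context: A transit function on $V$ is a map $R:V\times V\to 2^V$ with $u\in R(u,v)$, $R(u,v)=R(v,u)$, $R(u,u)=\{u\}$ for all $u,v\in V$; monotone means $p,q\in R(u,v)$ implies $R(p,q)\subseteq R(u,v)$. Sets $A,B$ overlap, $A\between B$, if $A\cap B$, $A\setminus B$, $B\setminus A$ are all non-empty. A weak $\beta$-cycle in a set system $\mathscr{C}$ is a sequence of $n\ge3$ sets $C_1,\dots,C_n\in\mathscr{C}$ with vertices $x_1,\dots,x_n$ such that $x_i\in C_i\cap C_{i+1}$ and $x_i\notin C_k$ for all $k\notin\{i,i+1\}$ (indices modulo $n$). $\mathscr{C}$ is totally balanced if it contains no weak $\beta$-cycle. -}

module Defs where

open import Data.Nat using (ℕ; suc; _≤_)
open import Data.Nat.DivMod using (_mod_)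
open import Data.Fin using (Fin; toℕ)
open import Data.Fin.Subset using (Subset; _∈_; _∉_; _⊆_; _∩_; _∪_; _─_; ⁅_⁆; Nonempty; Empty)
open import Data.Product using (Σ; ∃; ∃-syntax; _×_)
open import Data.Sum using (_⊎_)
open import Relation.Binary.PropositionalEquality using (_≡_; _≢_)
open import Relation.Nullary using (¬_)

IsTransit : ∀ {n} → (Fin n → Fin n → Subset n) → Set
IsTransit {n} R =
  (∀ (u v : Fin n) → u ∈ R u v) ×
  (∀ (u v : Fin n) → R u v ≡ R v u) ×
  (∀ (u : Fin n) → R u u ≡ ⁅ u ⁆)

IsMonotone : ∀ {n} → (Fin n → Fin n → Subset n) → Set
IsMonotone {n} R =
  ∀ (u v p q : Fin n) → p ∈ R u v → q ∈ R u v → R p q ⊆ R u v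

Overlap : ∀ {n} → Subset n → Subset n → Set
Overlap A B = Nonempty (A ∩ B) × Nonempty (A ─ B) × Nonempty (B ─ A)

L1 : ∀ {n} → (Fin n → Fin n → Subset n) → Set
L1 {n} R = ∀ (x y p q u v : Fin n) →
  Overlap (R x y) (R p q) → Overlap (R p q) (R u v) →
  (R x y ⊆ R u v) ⊎ (R u v ⊆ R x y) ⊎
  ((R x y ∩ R u v ⊆ R p q) × (R p q ⊆ R x y ∪ R u v))

L2 : ∀ {n} → (Fin n → Fin n → Subset n) → Set
L2 {n} R = ∀ (x y p q u v : Fin n) →
  Overlap (R x y) (R p q) → Overlap (R p q) (R u v) →
  Empty (R x y ∩ R u v) →
  ∃[ s ] ∃[ t ] (s ∈ R x y ─ R p q × t ∈ R u v ─ R p q ×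
                 R x y ∪ R p q ∪ R u v ≡ R s t)

next : ∀ {m} → Fin (suc m) → Fin (suc m)
next {m} i = suc (toℕ i) mod suc m

SetSystem : ℕ → Set₁
SetSystem n = Subset n → Set

WeakBetaCycle : ∀ {n} → SetSystem n → Set
WeakBetaCycle {n} 𝒞 =
  Σ ℕ λ m' → (3 ≤ suc m') ×
  Σ (Fin (suc m') → Subset n) λ C → (∀ i → 𝒞 (C i)) ×
  Σ (Fin (suc m') → Fin n) λ x →
    ∀ i → (x i ∈ C i) × (x i ∈ C (next i)) ×
          (∀ k → k ≢ i → k ≢ next i → x i ∉ C k)

TotallyBalanced : ∀ {n} → SetSystem n → Set
TotallyBalanced 𝒞 = ¬ WeakBetaCycle 𝒞

𝒞 : ∀ {n} → (Fin n → Fin n → Subset n) → SetSystem n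
𝒞 {n} R A = ∃[ x ] ∃[ y ] (R x y ≡ A)

{-# OPTIONS --safe #-}
-- By induction on its length, every weak β-cycle P₀, …, Pₘ of intervals yields a shorter one or a
-- contradiction. For m = 2, (l1) forces P₀ ∩ P₂ ⊆ P₁, against the closing vertex. For m ≥ 3 look at
-- P₀ ∩ P₂. If it contains some z ∉ P₁, then P₀, P₁, P₂ closed by z is a triangle. If z ∈ P₁ ∩ P₃ as
-- well, the intervals from z to the linking vertices y₀, y₁, y₂ contradict (l1). Otherwise z, followed
-- along the cycle, cuts off a shorter cycle avoiding P₁. If P₀ ∩ P₂ = ∅, (l2) merges P₀, P₁, P₂ into
-- one interval, shortening the cycle by two; for m = 3 that interval instead lies inside P₃ by (l1),
-- contradicting the vertex y₁.
module Submission where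

open import Defs
open import Data.Nat using (ℕ; suc; zero; pred; _+_; _≤_; _<_; z≤n; s≤s; s≤s⁻¹; z<s; s<s; _≟_)
open import Data.Nat.Properties
  using (+-suc; +-identityʳ; +-cancelˡ-≡; +-monoʳ-≤; +-monoʳ-<; ≤-refl; ≤-trans; <-≤-trans; <-trans;
         n<1+n; m≤n⇒m≤1+n; m<n⇒m<1+n; m≤m+n; m≤n⇒m<n∨m≡n; ≤∧≢⇒<; <⇒≤; <⇒≢; >⇒≢)
open import Data.Nat.DivMod using (_mod_; m≤n⇒m%n≡m; n%n≡0)
open import Data.Nat.Induction using (<-rec)
open import Data.Fin using (Fin; toℕ)
open import Data.Fin.Properties using (toℕ-fromℕ<; toℕ-injective)
open import Data.Fin.Subset using (Subset; _∈_; _∉_; _⊆_; _∩_; _∪_; _─_; Nonempty; Empty; inside; outside)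
open import Data.Fin.Subset.Properties
  using (_∈?_; nonempty?; x∈p∩q⁺; x∈p∩q⁻; x∈p∪q⁺; x∈p∪q⁻; x∈p∧x∉q⇒x∈p─q; p─q⊆p)
open import Data.Vec.Base using (_∷_; here; there)
open import Data.Product using (∃-syntax; _×_; _,_; proj₁; proj₂)
open import Data.Sum using (_⊎_; inj₁; inj₂; [_,_]′; map₂)
open import Data.Empty using (⊥; ⊥-elim)
open import Function using (_∘_)
open import Relation.Binary.PropositionalEquality using (_≡_; _≢_; refl; sym; trans; cong; subst)
open import Relation.Nullary using (¬_; yes; no)
open import Relation.Unary using (Decidable)

x∈p─q⇒x∉q : ∀ {n} (p q : Subset n) {x} → x ∈ p ─ q → x ∉ q
x∈p─q⇒x∉q (inside  ∷ p) (inside ∷ q) () here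
x∈p─q⇒x∉q (outside ∷ p) (inside ∷ q) () here
x∈p─q⇒x∉q (_ ∷ p) (_ ∷ q) (there x∈p─q) (there x∈q) = x∈p─q⇒x∉q p q x∈p─q x∈q

x∈p∪q∧x∉q⇒x∈p : ∀ {n} {p q : Subset n} {x} → x ∈ p ∪ q → x ∉ q → x ∈ p
x∈p∪q∧x∉q⇒x∈p {p = p} {q} x∈p∪q x∉q = [ (λ x∈p → x∈p) , (λ x∈q → ⊥-elim (x∉q x∈q)) ]′ (x∈p∪q⁻ p q x∈p∪q)

x∈p∪q∧x∉p⇒x∈q : ∀ {n} {p q : Subset n} {x} → x ∈ p ∪ q → x ∉ p → x ∈ q
x∈p∪q∧x∉p⇒x∈q {p = p} {q} x∈p∪q x∉p = [ (λ x∈p → ⊥-elim (x∉p x∈p)) , (λ x∈q → x∈q) ]′ (x∈p∪q⁻ p q x∈p∪q)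

x∉p∧x∉q⇒x∉p∪q : ∀ {n} {p q : Subset n} {x} → x ∉ p → x ∉ q → x ∉ p ∪ q
x∉p∧x∉q⇒x∉p∪q {p = p} {q} x∉p x∉q x∈p∪q = [ x∉p , x∉q ]′ (x∈p∪q⁻ p q x∈p∪q)

overlapping : ∀ {n} {A B : Subset n} {z a b} →
              z ∈ A → z ∈ B → a ∈ A → a ∉ B → b ∈ B → b ∉ A → Overlap A B
overlapping z∈A z∈B a∈A a∉B b∈B b∉A =
  (_ , x∈p∩q⁺ (z∈A , z∈B)) , (_ , x∈p∧x∉q⇒x∈p─q a∈A a∉B) , (_ , x∈p∧x∉q⇒x∈p─q b∈B b∉A)

setAt : ∀ {A : Set} → (ℕ → A) → ℕ → A → ℕ → A
setAt f k a l with l ≟ k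
... | yes _ = a
... | no  _ = f l

setAt-elim : ∀ {A : Set} (Q : A → Set) (f : ℕ → A) k a l →
             (l ≢ k → Q (f l)) → (l ≡ k → Q a) → Q (setAt f k a l)
setAt-elim Q f k a l elsewhere at with l ≟ k
... | yes l≡k = at l≡k
... | no  l≢k = elsewhere l≢k

least-or-none : ∀ {Q : ℕ → Set} → Decidable Q → ∀ K →
  (∃[ b ] 0 < b × b ≤ K × Q b × (∀ l → 0 < l → l < b → ¬ Q l)) ⊎ (∀ l → 0 < l → l ≤ K → ¬ Q l)
least-or-none Q? zero = inj₂ λ { zero () _ ; (suc l) _ () }
least-or-none Q? (suc K) with least-or-none Q? K
... | inj₁ (b , 0<b , b≤K , Qb , below) = inj₁ (b , 0<b , m≤n⇒m≤1+n b≤K , Qb , below)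
... | inj₂ none with Q? (suc K)
...   | yes Q[1+K] = inj₁ (suc K , z<s , ≤-refl , Q[1+K] , λ l 0<l l<1+K → none l 0<l (s≤s⁻¹ l<1+K))
...   | no ¬Q[1+K] = inj₂ λ l 0<l l≤1+K →
  [ (λ l<1+K → none l 0<l (s≤s⁻¹ l<1+K)) , (λ { refl → ¬Q[1+K] }) ]′ (m≤n⇒m<n∨m≡n l≤1+K)

module _ {M : ℕ} where

  toℕ-mod : ∀ j → j ≤ M → toℕ (j mod suc M) ≡ j
  toℕ-mod j j≤M = trans (toℕ-fromℕ< _) (m≤n⇒m%n≡m j≤M)

  mod-injective : ∀ i j → i ≤ M → j ≤ M → i mod suc M ≡ j mod suc M → i ≡ j
  mod-injective i j i≤M j≤M e = trans (sym (toℕ-mod i i≤M)) (trans (cong toℕ e) (toℕ-mod j j≤M))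

  next-mod : ∀ j → j ≤ M → next (j mod suc M) ≡ suc j mod suc M
  next-mod j j≤M = cong (λ t → suc t mod suc M) (toℕ-mod j j≤M)

  next-last : next (M mod suc M) ≡ 0 mod suc M
  next-last = trans (next-mod M ≤-refl) (toℕ-injective (trans (toℕ-fromℕ< _) (n%n≡0 (suc M))))

-- Weak β-cycles in a set system S, indexed by ℕ: the sets are P 0 … P m, the vertex y j links
-- P j to P (j + 1), and w closes the cycle by linking P m back to P 0.
module _ {N : ℕ} (S : SetSystem N) where

  record Path (m : ℕ) (P : ℕ → Subset N) (y : ℕ → Fin N) : Set where
    field
      members : ∀ l → l ≤ m → S (P l)
      y∈P     : ∀ j → j < m → y j ∈ P j
      y∈Psuc  : ∀ j → j < m → y j ∈ P (suc j)
      y∉P     : ∀ j l → j < m → l ≤ m → l ≢ j → l ≢ suc j → y j ∉ P l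

  record Cycle (m : ℕ) (P : ℕ → Subset N) (y : ℕ → Fin N) (w : Fin N) : Set where
    field
      long    : 2 ≤ m
      path    : Path m P y
      w∈P₀    : w ∈ P 0
      w∈Pₘ    : w ∈ P m
      w∉inner : ∀ l → 0 < l → l < m → w ∉ P l
    open Path path public

  data ShorterCycle (m : ℕ) : Set where
    shorter : ∀ {m′ P y w} → m′ < m → Cycle m′ P y w → ShorterCycle m

  segment : ∀ {m P y} a k → a + k ≤ m → Path m P y →
            Path k (λ l → P (a + l)) (λ j → y (a + j))
  segment {P = P} {y} a k a+k≤m p = record
    { members = λ l l≤k → members (a + l) (shift-≤ l≤k)
    ; y∈P     = λ j j<k → y∈P (a + j) (shift-< j<k)
    ; y∈Psuc  = λ j j<k → subst (λ i → y (a + j) ∈ P i) (sym (+-suc a j)) (y∈Psuc (a + j) (shift-< j<k))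
    ; y∉P     = λ j l j<k l≤k l≢j l≢1+j → y∉P (a + j) (a + l) (shift-< j<k) (shift-≤ l≤k)
                  (l≢j ∘ +-cancelˡ-≡ a l j) (l≢1+j ∘ +-cancelˡ-≡ a l (suc j) ∘ λ e → trans e (sym (+-suc a j)))
    }
    where
    open Path p
    shift-≤ : ∀ {l} → l ≤ k → a + l ≤ _
    shift-≤ l≤k = ≤-trans (+-monoʳ-≤ a l≤k) a+k≤m
    shift-< : ∀ {j} → j < k → a + j < _
    shift-< j<k = <-≤-trans (+-monoʳ-< a j<k) a+k≤m

  append : ∀ {m P y D v} → Path m P y → S D → v ∈ P m → v ∈ D →
           (∀ l → l < m → v ∉ P l) → (∀ j → j < m → y j ∉ D) →
           Path (suc m) (setAt P (suc m) D) (setAt y m v)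
  append {m} {P} {y} {D} {v} p D∈S v∈Pm v∈D v∉P y∉D = record
    { members = λ l l≤1+m → setAt-elim S P (suc m) D l (λ l≢1+m → members l (below-top l≤1+m l≢1+m)) (λ _ → D∈S)
    ; y∈P     = λ j j<1+m → setAt-elim (_∈ P′ j) y m v j
                  (λ j≢m → old (y∈P j (below j<1+m j≢m)) (<⇒≢ (m<n⇒m<1+n (below j<1+m j≢m))))
                  (λ { refl → old v∈Pm (<⇒≢ (n<1+n m)) })
    ; y∈Psuc  = λ j j<1+m → setAt-elim (_∈ P′ (suc j)) y m v j
                  (λ j≢m → old (y∈Psuc j (below j<1+m j≢m)) (λ e → j≢m (cong pred e)))
                  (λ { refl → setAt-elim (v ∈_) P (suc m) D (suc m) (λ ne → ⊥-elim (ne refl)) (λ _ → v∈D) })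
    ; y∉P     = λ j l j<1+m l≤1+m l≢j l≢1+j → setAt-elim (λ u → u ∉ P′ l) y m v j
                  (λ j≢m → setAt-elim (y j ∉_) P (suc m) D l
                    (λ l≢1+m → y∉P j l (below j<1+m j≢m) (below-top l≤1+m l≢1+m) l≢j l≢1+j)
                    (λ _ → y∉D j (below j<1+m j≢m)))
                  (λ { refl → setAt-elim (v ∉_) P (suc m) D l
                    (λ l≢1+m → v∉P l (≤∧≢⇒< (below-top l≤1+m l≢1+m) l≢j))
                    (λ l≡1+m → ⊥-elim (l≢1+j l≡1+m)) })
    }
    where
    open Path p
    P′ : ℕ → Subset _
    P′ = setAt P (suc m) D
    below-top : ∀ {l k} → l ≤ suc k → l ≢ suc k → l ≤ k
    below-top l≤1+k l≢1+k = s≤s⁻¹ (≤∧≢⇒< l≤1+k l≢1+k)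
    below : ∀ {j k} → j < suc k → j ≢ k → j < k
    below j<1+k j≢k = ≤∧≢⇒< (s≤s⁻¹ j<1+k) j≢k
    old : ∀ {u l} → u ∈ P l → l ≢ suc m → u ∈ P′ l
    old {u} {l} u∈Pl l≢1+m = setAt-elim (u ∈_) P (suc m) D l (λ _ → u∈Pl) (⊥-elim ∘ l≢1+m)

  chord : ∀ {m P y z} a b → 2 ≤ b → a + b ≤ m → Path m P y →
          z ∈ P a → z ∈ P (a + b) → (∀ l → 0 < l → l < b → z ∉ P (a + l)) →
          Cycle b (λ l → P (a + l)) (λ j → y (a + j)) z
  chord {P = P} {z = z} a b 2≤b a+b≤m p z∈Pa z∈Pa+b z∉inner = record
    { long    = 2≤b
    ; path    = segment a b a+b≤m p
    ; w∈P₀    = subst (λ i → z ∈ P i) (sym (+-identityʳ a)) z∈Pa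
    ; w∈Pₘ    = z∈Pa+b
    ; w∉inner = z∉inner
    }

  -- The sets P 0 … P (a - 1) are replaced by the single set D, which w now links to P m.
  replacePrefixBy : ∀ {a k P y w D z} → 0 < a → Cycle (a + suc k) P y w → S D → w ∈ D →
    (∀ j → j < suc k → y (a + j) ∉ D) → z ∈ P a → z ∈ D → (∀ l → 0 < l → l ≤ suc k → z ∉ P (a + l)) →
    Cycle (suc (suc k)) (setAt (λ l → P (a + l)) (suc (suc k)) D) (setAt (λ j → y (a + j)) (suc k) w) z
  replacePrefixBy {a} {k} {P} {D = D} {z} 0<a c D∈S w∈D y∉D z∈Pa z∈D z∉P = record
    { long    = s≤s (s≤s z≤n)
    ; path    = append (segment a (suc k) ≤-refl path) D∈S w∈Pₘ w∈D
                  (λ l l<1+k → w∉inner (a + l) (<-≤-trans 0<a (m≤m+n a l)) (+-monoʳ-< a l<1+k))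
                  y∉D
    ; w∈P₀    = setAt-elim (z ∈_) (λ l → P (a + l)) (suc (suc k)) D 0
                  (λ _ → subst (λ i → z ∈ P i) (sym (+-identityʳ a)) z∈Pa) (λ ())
    ; w∈Pₘ    = setAt-elim (z ∈_) (λ l → P (a + l)) (suc (suc k)) D (suc (suc k)) (λ ne → ⊥-elim (ne refl)) (λ _ → z∈D)
    ; w∉inner = λ l 0<l l<2+k → setAt-elim (z ∉_) (λ l → P (a + l)) (suc (suc k)) D l
                  (λ _ → z∉P l 0<l (s≤s⁻¹ l<2+k)) (λ l≡2+k → ⊥-elim (<⇒≢ l<2+k l≡2+k))
    }
    where open Cycle c

  module _ {m P y w} (c : Cycle m P y w) where
    open Cycle c

    leaving : ∀ j → j < m → Nonempty (P j ─ P (suc j))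
    leaving zero    _     = w , x∈p∧x∉q⇒x∈p─q w∈P₀ (w∉inner 1 z<s long)
    leaving (suc i) 1+i<m = y i , x∈p∧x∉q⇒x∈p─q (y∈Psuc i (<-trans (n<1+n i) 1+i<m))
      (y∉P i (suc (suc i)) (<-trans (n<1+n i) 1+i<m) 1+i<m (>⇒≢ (m<n⇒m<1+n (n<1+n i))) (>⇒≢ (n<1+n (suc i))))

    entering : ∀ j → j < m → Nonempty (P (suc j) ─ P j)
    entering j j<m with m≤n⇒m<n∨m≡n j<m
    ... | inj₁ 1+j<m = y (suc j) , x∈p∧x∉q⇒x∈p─q (y∈P (suc j) 1+j<m)
            (y∉P (suc j) j 1+j<m (<⇒≤ j<m) (<⇒≢ (n<1+n j)) (<⇒≢ (m<n⇒m<1+n (n<1+n j))))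
    ... | inj₂ refl  = w , x∈p∧x∉q⇒x∈p─q w∈Pₘ (w∉inner j (s≤s⁻¹ long) j<m)

    overlap-next : ∀ j → j < m → Overlap (P j) (P (suc j))
    overlap-next j j<m = (y j , x∈p∩q⁺ (y∈P j j<m , y∈Psuc j j<m)) , leaving j j<m , entering j j<m

  overlap-close : ∀ {m P y w} → Cycle (suc (suc m)) P y w → Overlap (P (suc (suc m))) (P 0)
  overlap-close {m} c = overlapping w∈Pₘ w∈P₀
    (y∈Psuc (suc m) ≤-refl) (y∉P (suc m) 0 ≤-refl z≤n (λ ()) (λ ()))
    (y∈P 0 z<s) (y∉P 0 (suc (suc m)) z<s ≤-refl (λ ()) (λ ()))
    where open Cycle c

  module FirstSets {k P y w} (c : Cycle (3 + k) P y w) where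
    open Cycle c public

    P₀∈S : S (P 0)
    P₀∈S = members 0 z≤n
    P₁∈S : S (P 1)
    P₁∈S = members 1 (s≤s z≤n)
    P₂∈S : S (P 2)
    P₂∈S = members 2 (s≤s (s≤s z≤n))
    P₃∈S : S (P 3)
    P₃∈S = members 3 (s≤s (s≤s (s≤s z≤n)))

    y₀∈P₀ : y 0 ∈ P 0
    y₀∈P₀ = y∈P 0 z<s
    y₀∈P₁ : y 0 ∈ P 1
    y₀∈P₁ = y∈Psuc 0 z<s
    y₁∈P₁ : y 1 ∈ P 1
    y₁∈P₁ = y∈P 1 (s<s z<s)
    y₁∈P₂ : y 1 ∈ P 2
    y₁∈P₂ = y∈Psuc 1 (s<s z<s)
    y₂∈P₂ : y 2 ∈ P 2
    y₂∈P₂ = y∈P 2 (s<s (s<s z<s))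
    y₂∈P₃ : y 2 ∈ P 3
    y₂∈P₃ = y∈Psuc 2 (s<s (s<s z<s))

    y₀∉P₂ : y 0 ∉ P 2
    y₀∉P₂ = y∉P 0 2 z<s (s≤s (s≤s z≤n)) (λ ()) (λ ())
    y₀∉P₃ : y 0 ∉ P 3
    y₀∉P₃ = y∉P 0 3 z<s (s≤s (s≤s (s≤s z≤n))) (λ ()) (λ ())
    y₁∉P₀ : y 1 ∉ P 0
    y₁∉P₀ = y∉P 1 0 (s<s z<s) z≤n (λ ()) (λ ())
    y₁∉P₃ : y 1 ∉ P 3
    y₁∉P₃ = y∉P 1 3 (s<s z<s) (s≤s (s≤s (s≤s z≤n))) (λ ()) (λ ())
    y₂∉P₀ : y 2 ∉ P 0
    y₂∉P₀ = y∉P 2 0 (s<s (s<s z<s)) z≤n (λ ()) (λ ())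
    y₂∉P₁ : y 2 ∉ P 1
    y₂∉P₁ = y∉P 2 1 (s<s (s<s z<s)) (s≤s z≤n) (λ ()) (λ ())

    w∉P₁ : w ∉ P 1
    w∉P₁ = w∉inner 1 z<s (s<s z<s)

    P₀⋈P₁ : Overlap (P 0) (P 1)
    P₀⋈P₁ = overlap-next c 0 z<s
    P₁⋈P₂ : Overlap (P 1) (P 2)
    P₁⋈P₂ = overlap-next c 1 (s<s z<s)

  toCycle : WeakBetaCycle S → ∃[ m ] ∃[ P ] ∃[ y ] ∃[ w ] Cycle m P y w
  toCycle (M , 3≤1+M , C , C∈S , x , cyc) = M , P , y , y M , record
    { long    = s≤s⁻¹ 3≤1+M
    ; path    = record
      { members = λ l _ → C∈S (l mod suc M)
      ; y∈P     = λ j _ → proj₁ (cyc (j mod suc M))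
      ; y∈Psuc  = λ j j<M → subst (λ i → y j ∈ C i) (next-mod j (<⇒≤ j<M)) (proj₁ (proj₂ (cyc (j mod suc M))))
      ; y∉P     = λ j l j<M l≤M l≢j l≢1+j → proj₂ (proj₂ (cyc (j mod suc M))) (l mod suc M)
                    (l≢j ∘ mod-injective l j l≤M (<⇒≤ j<M))
                    (λ e → l≢1+j (mod-injective l (suc j) l≤M j<M (trans e (next-mod j (<⇒≤ j<M)))))
      }
    ; w∈P₀    = subst (λ i → y M ∈ C i) next-last (proj₁ (proj₂ (cyc (M mod suc M))))
    ; w∈Pₘ    = proj₁ (cyc (M mod suc M))
    ; w∉inner = λ l 0<l l<M → proj₂ (proj₂ (cyc (M mod suc M))) (l mod suc M)
                  (<⇒≢ l<M ∘ mod-injective l M (<⇒≤ l<M) ≤-refl)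
                  (λ e → >⇒≢ 0<l (mod-injective l 0 (<⇒≤ l<M) z≤n (trans e next-last)))
    }
    where
    P : ℕ → Subset N
    P l = C (l mod suc M)
    y : ℕ → Fin N
    y j = x (j mod suc M)

module _ {N : ℕ} {R : Fin N → Fin N → Subset N}
         (transit : IsTransit R) (monotone : IsMonotone R) (l1 : L1 R) (l2 : L2 R) where

  ∈R-left : ∀ u v → u ∈ R u v
  ∈R-left = proj₁ transit

  ∈R-right : ∀ u v → v ∈ R u v
  ∈R-right u v = subst (v ∈_) (proj₁ (proj₂ transit) v u) (∈R-left v u)

  𝒞-monotone : ∀ {A p q} → 𝒞 R A → p ∈ A → q ∈ A → R p q ⊆ A
  𝒞-monotone (a , b , refl) = monotone a b _ _

  l1-between : ∀ {A B C} → 𝒞 R A → 𝒞 R B → 𝒞 R C → Overlap A B → Overlap B C →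
               ¬ A ⊆ C → ¬ C ⊆ A → (A ∩ C ⊆ B) × (B ⊆ A ∪ C)
  l1-between (a , b , refl) (c , d , refl) (e , f , refl) A⋈B B⋈C A⊈C C⊈A
    with l1 a b c d e f A⋈B B⋈C
  ... | inj₁ A⊆C         = ⊥-elim (A⊈C A⊆C)
  ... | inj₂ (inj₁ C⊆A)  = ⊥-elim (C⊈A C⊆A)
  ... | inj₂ (inj₂ between) = between

  l2-𝒞 : ∀ {A B C} → 𝒞 R A → 𝒞 R B → 𝒞 R C → Overlap A B → Overlap B C → Empty (A ∩ C) →
         ∃[ s ] ∃[ t ] (s ∈ A ─ B × t ∈ C ─ B × A ∪ B ∪ C ≡ R s t)
  l2-𝒞 (a , b , refl) (c , d , refl) (e , f , refl) = l2 a b c d e f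

  Acyclic : ℕ → Set
  Acyclic m = ∀ {P y w} → ¬ Cycle (𝒞 R) m P y w

  no-2-cycle : Acyclic 2
  no-2-cycle c = w∉inner 1 z<s ≤-refl (proj₁ P₀∩P₂⊆P₁ (x∈p∩q⁺ (w∈P₀ , w∈Pₘ)))
    where
    open Cycle c
    P₀∩P₂⊆P₁ = l1-between (members 0 z≤n) (members 1 (s≤s z≤n)) (members 2 ≤-refl)
                 (overlap-next _ c 0 z<s) (overlap-next _ c 1 ≤-refl)
                 (λ P₀⊆P₂ → y∉P 0 2 z<s ≤-refl (λ ()) (λ ()) (P₀⊆P₂ (y∈P 0 z<s)))
                 (λ P₂⊆P₀ → y∉P 1 0 ≤-refl z≤n (λ ()) (λ ()) (P₂⊆P₀ (y∈Psuc 1 ≤-refl)))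

  -- The intervals R(z,y₀), R(z,y₁), R(z,y₂) lie in P₀, P₁ ∩ P₂ and P₂ ∩ P₃ by monotonicity, so they
  -- overlap in a chain; (l1) then puts y₁ into P₀ or P₃.
  no-hub : ∀ {k P y w z} → Cycle (𝒞 R) (3 + k) P y w → z ∈ P 0 → z ∈ P 1 → z ∈ P 2 → z ∈ P 3 → ⊥
  no-hub {y = y} {z = z} c z∈P₀ z∈P₁ z∈P₂ z∈P₃ =
    [ (λ y₁∈B₀ → y₁∉P₀ (B₀⊆P₀ y₁∈B₀)) , (λ y₁∈B₂ → y₁∉P₃ (B₂⊆P₃ y₁∈B₂)) ]′
      (x∈p∪q⁻ (R z (y 0)) (R z (y 2)) (proj₂ B₁⊆B₀∪B₂ (∈R-right z (y 1))))
    where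
    open FirstSets _ c
    B₀⊆P₀ = 𝒞-monotone P₀∈S z∈P₀ y₀∈P₀
    B₁⊆P₁ = 𝒞-monotone P₁∈S z∈P₁ y₁∈P₁
    B₁⊆P₂ = 𝒞-monotone P₂∈S z∈P₂ y₁∈P₂
    B₂⊆P₂ = 𝒞-monotone P₂∈S z∈P₂ y₂∈P₂
    B₂⊆P₃ = 𝒞-monotone P₃∈S z∈P₃ y₂∈P₃
    B₁⊆B₀∪B₂ = l1-between (z , y 0 , refl) (z , y 1 , refl) (z , y 2 , refl)
      (overlapping (∈R-left z (y 0)) (∈R-left z (y 1)) (∈R-right z (y 0)) (y₀∉P₂ ∘ B₁⊆P₂)
                   (∈R-right z (y 1)) (y₁∉P₀ ∘ B₀⊆P₀))
      (overlapping (∈R-left z (y 1)) (∈R-left z (y 2)) (∈R-right z (y 1)) (y₁∉P₃ ∘ B₂⊆P₃)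
                   (∈R-right z (y 2)) (y₂∉P₁ ∘ B₁⊆P₁))
      (λ B₀⊆B₂ → y₀∉P₂ (B₂⊆P₂ (B₀⊆B₂ (∈R-right z (y 0)))))
      (λ B₂⊆B₀ → y₂∉P₀ (B₀⊆P₀ (B₂⊆B₀ (∈R-right z (y 2)))))

  -- (l2) merges P₀, P₁, P₂ into an interval R(s,t); (l1) places s and t in P₃, so R(s,t) ⊆ P₃ contains y₁.
  no-disjoint-4-cycle : ∀ {P y w} → Cycle (𝒞 R) 3 P y w → Empty (P 0 ∩ P 2) → ⊥
  no-disjoint-4-cycle {P} {y} c P₀∩P₂=∅ =
    y₁∉P₃ (𝒞-monotone P₃∈S s∈P₃ t∈P₃ (subst (y 1 ∈_) P₀∪P₁∪P₂≡Rst (x∈p∪q⁺ (inj₂ (x∈p∪q⁺ (inj₁ y₁∈P₁))))))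
    where
    open FirstSets _ c
    merged = l2-𝒞 P₀∈S P₁∈S P₂∈S P₀⋈P₁ P₁⋈P₂ P₀∩P₂=∅
    s = proj₁ merged
    t = proj₁ (proj₂ merged)
    s∈P₀─P₁ = proj₁ (proj₂ (proj₂ merged))
    t∈P₂─P₁ = proj₁ (proj₂ (proj₂ (proj₂ merged)))
    P₀∪P₁∪P₂≡Rst = proj₂ (proj₂ (proj₂ (proj₂ merged)))
    P₁⊈P₃ : ¬ P 1 ⊆ P 3
    P₁⊈P₃ P₁⊆P₃ = y₀∉P₃ (P₁⊆P₃ y₀∈P₁)
    P₃⊈P₁ : ¬ P 3 ⊆ P 1
    P₃⊈P₁ P₃⊆P₁ = w∉P₁ (P₃⊆P₁ w∈Pₘ)
    s∈P₃ : s ∈ P 3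
    s∈P₃ = x∈p∪q∧x∉q⇒x∈p
      (proj₂ (l1-between P₃∈S P₀∈S P₁∈S (overlap-close _ c) P₀⋈P₁ P₃⊈P₁ P₁⊈P₃) (p─q⊆p (P 0) (P 1) s∈P₀─P₁))
      (x∈p─q⇒x∉q (P 0) (P 1) s∈P₀─P₁)
    t∈P₃ : t ∈ P 3
    t∈P₃ = x∈p∪q∧x∉p⇒x∈q
      (proj₂ (l1-between P₁∈S P₂∈S P₃∈S P₁⋈P₂ (overlap-next _ c 2 ≤-refl) P₁⊈P₃ P₃⊈P₁) (p─q⊆p (P 2) (P 1) t∈P₂─P₁))
      (x∈p─q⇒x∉q (P 2) (P 1) t∈P₂─P₁)

  -- P₀ ∪ P₁ ∪ P₂ = R(s,t) from (l2) takes the place of P₀, P₁, P₂.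
  shrink-disjoint : ∀ {k P y w} → Cycle (𝒞 R) (4 + k) P y w → Empty (P 0 ∩ P 2) → ShorterCycle (𝒞 R) (4 + k)
  shrink-disjoint {P = P} c P₀∩P₂=∅ =
    shorter (m<n⇒m<1+n ≤-refl)
      (replacePrefixBy _ {a = 3} z<s c (s , t , refl) (∈D (inj₁ w∈P₀))
        (λ j j<1+k → ∉D (y∉P (3 + j) 0 (s≤s (s≤s (s≤s j<1+k))) z≤n (λ ()) (λ ()))
                        (y∉P (3 + j) 1 (s≤s (s≤s (s≤s j<1+k))) (s≤s z≤n) (λ ()) (λ ()))
                        (y∉P (3 + j) 2 (s≤s (s≤s (s≤s j<1+k))) (s≤s (s≤s z≤n)) (λ ()) (λ ())))
        y₂∈P₃ (∈D (inj₂ (inj₂ y₂∈P₂)))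
        (λ { (suc l) _ l<1+k → y∉P 2 (4 + l) (s<s (s<s z<s)) (s≤s (s≤s (s≤s l<1+k))) (λ ()) (λ ()) }))
    where
    open FirstSets _ c
    merged = l2-𝒞 P₀∈S P₁∈S P₂∈S P₀⋈P₁ P₁⋈P₂ P₀∩P₂=∅
    s = proj₁ merged
    t = proj₁ (proj₂ merged)
    P₀∪P₁∪P₂≡Rst = proj₂ (proj₂ (proj₂ (proj₂ merged)))
    ∈D : ∀ {u} → u ∈ P 0 ⊎ u ∈ P 1 ⊎ u ∈ P 2 → u ∈ R s t
    ∈D {u} u∈ = subst (u ∈_) P₀∪P₁∪P₂≡Rst (x∈p∪q⁺ (map₂ x∈p∪q⁺ u∈))
    ∉D : ∀ {u} → u ∉ P 0 → u ∉ P 1 → u ∉ P 2 → u ∉ R s t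
    ∉D {u} u∉P₀ u∉P₁ u∉P₂ u∈D =
      x∉p∧x∉q⇒x∉p∪q u∉P₀ (x∉p∧x∉q⇒x∉p∪q u∉P₁ u∉P₂) (subst (u ∈_) (sym P₀∪P₁∪P₂≡Rst) u∈D)

  -- z ∈ P₀ ∩ P₁ ∩ P₂ ∖ P₃: either z returns to a later set, cutting off a chord cycle, or the cycle
  -- P₂, …, Pₘ, P₀ closed by z skips P₁.
  shrink-via-return : ∀ {k P y w z} → Cycle (𝒞 R) (3 + k) P y w →
                      z ∈ P 0 → z ∈ P 2 → z ∉ P 3 → ShorterCycle (𝒞 R) (3 + k)
  shrink-via-return {k} {P} {z = z} c z∈P₀ z∈P₂ z∉P₃
    with least-or-none (λ l → z ∈? P (2 + l)) (suc k)
  ... | inj₁ (suc zero , _ , _ , z∈P₃ , _) = ⊥-elim (z∉P₃ z∈P₃)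
  ... | inj₁ (suc (suc b) , _ , 2+b≤1+k , z∈P , z∉P) =
    shorter (s≤s (m≤n⇒m≤1+n 2+b≤1+k))
      (chord _ 2 (2 + b) (s≤s (s≤s z≤n)) (s≤s (s≤s 2+b≤1+k)) (Cycle.path c) z∈P₂ z∈P z∉P)
  ... | inj₂ z∉P = shorter ≤-refl
      (replacePrefixBy _ {a = 2} z<s c P₀∈S w∈P₀
        (λ j j<1+k → y∉P (2 + j) 0 (s≤s (s≤s j<1+k)) z≤n (λ ()) (λ ())) z∈P₂ z∈P₀ z∉P)
    where open FirstSets _ c

  shrink-common : ∀ {k P y w z} → Cycle (𝒞 R) (3 + k) P y w → z ∈ P 0 → z ∈ P 2 → ShorterCycle (𝒞 R) (3 + k)
  shrink-common {P = P} {z = z} c z∈P₀ z∈P₂ with z ∈? P 1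
  ... | no z∉P₁ = shorter (s≤s (s≤s (s≤s z≤n)))
      (chord _ 0 2 ≤-refl (s≤s (s≤s z≤n)) (Cycle.path c) z∈P₀ z∈P₂
        λ { (suc zero) _ _ → z∉P₁ ; (suc (suc _)) _ (s≤s (s≤s ())) })
  ... | yes z∈P₁ with z ∈? P 3
  ...   | yes z∈P₃ = ⊥-elim (no-hub c z∈P₀ z∈P₁ z∈P₂ z∈P₃)
  ...   | no  z∉P₃ = shrink-via-return c z∈P₀ z∈P₂ z∉P₃

  shrink : ∀ {k P y w} → Cycle (𝒞 R) (3 + k) P y w → ShorterCycle (𝒞 R) (3 + k)
  shrink {P = P} c with nonempty? (P 0 ∩ P 2)
  ... | yes (z , z∈P₀∩P₂) = shrink-common c (proj₁ (x∈p∩q⁻ (P 0) (P 2) z∈P₀∩P₂)) (proj₂ (x∈p∩q⁻ (P 0) (P 2) z∈P₀∩P₂))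
  shrink {zero}  c | no P₀∩P₂=∅ = ⊥-elim (no-disjoint-4-cycle c P₀∩P₂=∅)
  shrink {suc k} c | no P₀∩P₂=∅ = shrink-disjoint c P₀∩P₂=∅

  acyclic : ∀ m → Acyclic m
  acyclic = <-rec Acyclic step
    where
    step : ∀ m → (∀ {m′} → m′ < m → Acyclic m′) → Acyclic m
    step 0 _ c with Cycle.long c
    ... | ()
    step 1 _ c with Cycle.long c
    ... | s≤s ()
    step 2 _ c = no-2-cycle c
    step (suc (suc (suc k))) shorter-acyclic c with shrink c
    ... | shorter m′<m c′ = shorter-acyclic m′<m c′

mainTheorem13 : (n : ℕ) (R : Fin (suc n) → Fin (suc n) → Subset (suc n)) →
    IsTransit R → IsMonotone R → L1 R → L2 R → TotallyBalanced (𝒞 R)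
mainTheorem13 n R transit monotone l1 l2 β =
  let (m , P , y , w , c) = toCycle (𝒞 R) β in acyclic transit monotone l1 l2 m c
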